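{- A connected graph $G$ on $n$ vertices satisfies $\Gamma_{\rho}(G)=n-1$ if and only if all of the following hold: (i) $i(G)=2$; (ii) ${\rm diam}(G)\le 4$; (iii) if ${\rm rad}(G)=3$, then there exist a maximal independent set $\{x,y\}$ of $G$ with $d(x,y)=3$ and a vertex $w\in N(x)$ such that $d(w,z)\le 2$ for every vertex $z\in N(y)$; (iv) if ${\rm rad}(G)=2$ and ${\rm diam}(G)=4$, then there exists a maximal independent set $A$ of $G$ with $|A|=2$ that avoids one central vertex $w$ and one additional non-diametrical vertex $z\ne w$ (i.e. $w,z\notin A$).
   Context: Graphs are finite and simple; $d(u,v)$ is the distance in $G$; $N(v)$ is the open neighborhood of $v$. The eccentricity of $v$ is $\max_u d(u,v)$; ${\rm rad}(G)$ and ${\rm diam}(G)$ are the minimum and maximum eccentricity; a central vertex has eccentricity ${\rm rad}(G)$; a diametrical vertex has eccentricity ${\rm diam}(G)$, and a non-diametrical vertex is one that is not diametrical. $i(G)$ is the minimum cardinality of a maximal independent set of $G$ (an $i(G)$-set is a maximal independent set of that cardinality). A packing coloring $c:V(G)\to\{1,\dots,k\}$ satisfies: $c(u)=c(v)=i$, $u\ne v$, implies $d(u,v)>i$. The Grundy packing chromatic number $\Gamma_{\rho}(G)$ is the maximum number of colors $k$ in a packing coloring $c:V(G)\to\{1,\dots,k\}$ using all $k$ colors in which every vertex $v$ with $c(v)=i$ has, for every $j\in\{1,\dots,i-1\}$, a vertex $u$ with $c(u)=j$ and $d(u,v)\le j$ (equivalently, the maximum number of colors produced by the greedy procedure that processes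 vertices in some order and assigns each vertex the smallest color $i$ with no already-colored vertex of color $i$ at distance at most $i$). -}

module Defs where

open import Data.Nat using (ℕ; zero; suc; _≤_; _<_)
open import Data.Fin using (Fin)
open import Data.Fin.Subset using (Subset; _∈_; _∉_; _⊆_; ∣_∣; ⁅_⁆; _∪_)
open import Data.Bool using (Bool; true; false)
open import Data.Product using (_×_; Σ; ∃; ∃-syntax; _,_)
open import Relation.Nullary using (¬_)
open import Relation.Binary.PropositionalEquality using (_≡_; _≢_)

record Graph (n : ℕ) : Set where
  field
    edge  : Fin n → Fin n → Bool
    sym   : ∀ u v → edge u v ≡ edge v u
    irrefl : ∀ u → edge u u ≡ false

module _ {n : ℕ} (G : Graph n) where
  open Graph G

  Adj : Fin n → Fin n → Set
  Adj u v = edge u v ≡ true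

  -- WalkLe k u v : there is a walk from u to v of length at most k,
  -- i.e. d(u,v) ≤ k.
  data WalkLe : ℕ → Fin n → Fin n → Set where
    here : ∀ {k u} → WalkLe k u u
    step : ∀ {k u w v} → Adj u w → WalkLe k w v → WalkLe (suc k) u v

  Connected : Set
  Connected = ∀ u v → ∃[ k ] WalkLe k u v

  Dist : Fin n → Fin n → ℕ → Set
  Dist u v k = WalkLe k u v × (∀ j → WalkLe j u v → k ≤ j)

  Ecc : Fin n → ℕ → Set
  Ecc v e = (∀ u → WalkLe e u v) × (∃[ u ] Dist u v e)

  Rad : ℕ → Set
  Rad r = (∃[ v ] Ecc v r) × (∀ v e → Ecc v e → r ≤ e)

  Diam : ℕ → Set
  Diam D = (∃[ v ] Ecc v D) × (∀ v e → Ecc v e → e ≤ D)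

  Central : Fin n → Set
  Central v = ∃[ r ] (Rad r × Ecc v r)

  Diametrical : Fin n → Set
  Diametrical v = ∃[ D ] (Diam D × Ecc v D)

  Independent : Subset n → Set
  Independent A = ∀ u v → u ∈ A → v ∈ A → ¬ Adj u v

  MaximalIndependent : Subset n → Set
  MaximalIndependent A =
    Independent A × (∀ B → A ⊆ B → Independent B → B ⊆ A)

  IndepDomNum : ℕ → Set
  IndepDomNum k =
    (∃[ A ] (MaximalIndependent A × ∣ A ∣ ≡ k))
    × (∀ A → MaximalIndependent A → k ≤ ∣ A ∣)

  GrundyPackingColoring : ℕ → (Fin n → ℕ) → Set
  GrundyPackingColoring k c =
    (∀ v → 1 ≤ c v × c v ≤ k)
    × (∀ i → 1 ≤ i → i ≤ k → ∃[ v ] c v ≡ i)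
    × (∀ u v → u ≢ v → c u ≡ c v → ¬ WalkLe (c u) u v)
    × (∀ v j → 1 ≤ j → j < c v → ∃[ u ] (c u ≡ j × WalkLe j u v))

  GrundyPackingNumber : ℕ → Set
  GrundyPackingNumber k =
    (∃[ c ] GrundyPackingColoring k c)
    × (∀ k' c → GrundyPackingColoring k' c → k' ≤ k)

{-# OPTIONS --safe #-}
-- Write n = m + 1. If v is a universal vertex, giving every vertex its own colour, with 1 on
-- v, is a Grundy packing colouring, so Γρ(G) = n; otherwise colour 1 is used twice and
-- Γρ(G) ≤ n − 1. By counting, a colouring with n − 1 colours then has colour classes {x, y},
-- {v₂}, {v₃}, …, and its Grundy conditions for colours 1, 2, 3 say that {x, y} is a
-- non-adjacent dominating pair, that v₂ is within 2 of every vertex outside {x, y}, and that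
-- v₃ is within 3 of every vertex outside {x, y, v₂}: call this a frame. Conversely a frame
-- yields such a colouring, larger colours being served through v₂. So Γρ(G) = n − 1 iff
-- there is no universal vertex and there is a frame.
-- A frame gives (i)–(iv) with A = {x, y}. Conversely (i) gives a non-adjacent dominating
-- pair {x, y}, at distance at most 3. If no vertex has eccentricity 2, the radius is 3 and
-- (iii) yields a frame; if one has and the diameter is at most 3, a frame is built around
-- {x, y}; otherwise the radius is 2, the diameter 4, and (iv) yields a frame whose v₂ is
-- central and whose v₃ is not diametrical.
module Submission where

open import Defs
open import Data.Nat using (ℕ; zero; suc; _≤_; _<_; _∸_; _+_; z≤n; s≤s; _≤?_; _≟_)
open import Data.Nat.Properties
  using (≤-refl; ≤-reflexive; ≤-trans; ≤-antisym; ≤-pred; ≤-<-trans; <-≤-trans; <-trans; <⇒≢; <⇒≤;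
         <-irrefl; ≰⇒>; ≤∧≢⇒<; m<n⇒m<1+n; m<1+n⇒m<n∨m≡n; m≤n⇒m≤1+n; m≤n+m; n≤1+n; 1+n≰n;
         suc-injective; +-comm)
open import Data.Fin as Fin using (Fin; toℕ; fromℕ<)
open import Data.Fin.Properties
  using (toℕ<n; toℕ-fromℕ<; toℕ-injective; punchOut-injective; injective⇒≤; any?; all?; ¬∀⟶∃¬)
open import Data.Fin.Permutation
  using (Permutation; _⟨$⟩ʳ_; _⟨$⟩ˡ_; inverseˡ; inverseʳ; _∘ₚ_; transpose) renaming (id to idₚ)
import Data.Fin.Permutation.Components as Components
open import Data.Fin.Subset using (Subset; _∈_; _∉_; _⊆_; ∣_∣; ⁅_⁆; _∪_)
open import Data.Fin.Subset.Properties
  using (x∈⁅x⁆; x∈⁅y⁆⇒x≡y; x∈p∪q⁻; x∈p∪q⁺; ∣⁅x⁆∣≡1; ∪-identityˡ; ∪-identityʳ; ∪-idem; _∈?_; p⊆p∪q;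
         nonempty?; Empty-unique; ∣⊥∣≡0; p⊆q⇒∣p∣≤∣q∣; p⊂q⇒∣p∣<∣q∣)
open import Data.List using (applyUpTo)
open import Data.List.Relation.Unary.All as All using (All; []; _∷_)
open import Data.List.Membership.Propositional.Properties using (∈-applyUpTo⁺)
open import Data.Product using (_×_; ∃-syntax; _,_; proj₁; proj₂; swap)
open import Data.Bool as Bool using (true)
open import Data.Sum using (_⊎_; inj₁; inj₂)
open import Function using (_∘_)
open import Function.Bundles using (_⇔_; mk⇔)
open import Function.Definitions using (Injective)
open import Relation.Nullary using (¬_; Dec; yes; no; contradiction)
open import Relation.Nullary.Decidable using (_×-dec_)
open import Relation.Binary.PropositionalEquality
  using (_≡_; _≢_; refl; sym; trans; cong; subst; subst₂; ≢-sym)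

-- Numberings of a finite set

transpose-matchˡ : ∀ {n} (i j : Fin n) → Components.transpose i j i ≡ j
transpose-matchˡ i j with i Fin.≟ i
... | yes _ = refl
... | no i≢i = contradiction refl i≢i

transpose-fixes : ∀ {n} {i j k : Fin n} → k ≢ i → k ≢ j → Components.transpose i j k ≡ k
transpose-fixes {i = i} {j} {k} k≢i k≢j with k Fin.≟ i
... | yes k≡i = contradiction k≡i k≢i
... | no _ with k Fin.≟ j
...   | yes k≡j = contradiction k≡j k≢j
...   | no _ = refl

position-injective : ∀ {n} (σ : Permutation n n) {u v} → toℕ (σ ⟨$⟩ʳ u) ≡ toℕ (σ ⟨$⟩ʳ v) → u ≡ v
position-injective σ σu≡σv =
  trans (sym (inverseˡ σ)) (trans (cong (σ ⟨$⟩ˡ_) (toℕ-injective σu≡σv)) (inverseˡ σ))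

position-surjective : ∀ {n} (σ : Permutation n n) {i} → i < n → ∃[ u ] toℕ (σ ⟨$⟩ʳ u) ≡ i
position-surjective σ i<n = σ ⟨$⟩ˡ fromℕ< i<n , trans (cong toℕ (inverseʳ σ)) (toℕ-fromℕ< i<n)

-- The last step moves a k to position k by a transposition, which fixes the positions
-- below k, where a 0, …, a (k − 1) already are.
placeFirst : ∀ {n} k (a : ℕ → Fin n) → (∀ j → j < k → All (a j ≢_) (applyUpTo a j)) →
  ∃[ σ ] ∀ i → i < k → toℕ (σ ⟨$⟩ʳ a i) ≡ i
placeFirst zero a fresh = idₚ , λ _ ()
placeFirst {n} (suc k) a fresh with placeFirst k a (λ j j<k → fresh j (m<n⇒m<1+n j<k))
... | σ , placed = σ ∘ₚ transpose (σ ⟨$⟩ʳ a k) t , placed′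
  where
  k≤pos : k ≤ toℕ (σ ⟨$⟩ʳ a k)
  k≤pos with k ≤? toℕ (σ ⟨$⟩ʳ a k)
  ... | yes k≤pos = k≤pos
  ... | no k≰pos = contradiction (sym (position-injective σ (placed _ j<k)))
                                 (All.lookup (fresh k ≤-refl) (∈-applyUpTo⁺ a j<k))
    where
    j<k : toℕ (σ ⟨$⟩ʳ a k) < k
    j<k = ≰⇒> k≰pos
  k<n : k < n
  k<n = ≤-<-trans k≤pos (toℕ<n _)
  t : Fin n
  t = fromℕ< k<n
  placed′ : ∀ i → i < suc k → toℕ (Components.transpose (σ ⟨$⟩ʳ a k) t (σ ⟨$⟩ʳ a i)) ≡ i
  placed′ i i<1+k with m<1+n⇒m<n∨m≡n i<1+k
  ... | inj₂ refl = trans (cong toℕ (transpose-matchˡ (σ ⟨$⟩ʳ a k) t)) (toℕ-fromℕ< k<n)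
  ... | inj₁ i<k = trans (cong toℕ (transpose-fixes σai≢σak σai≢t)) (placed i i<k)
    where
    σai≢σak : σ ⟨$⟩ʳ a i ≢ σ ⟨$⟩ʳ a k
    σai≢σak e = <⇒≢ (<-≤-trans i<k k≤pos) (trans (sym (placed i i<k)) (cong toℕ e))
    σai≢t : σ ⟨$⟩ʳ a i ≢ t
    σai≢t e = <⇒≢ i<k (trans (sym (placed i i<k)) (trans (cong toℕ e) (toℕ-fromℕ< k<n)))

injective-missing⇒≤ : ∀ {k m} {f : Fin k → Fin (suc m)} → Injective _≡_ _≡_ f →
  (q : Fin (suc m)) → (∀ i → f i ≢ q) → k ≤ m
injective-missing⇒≤ f-inj q missed =
  injective⇒≤ (λ e → f-inj (punchOut-injective (missed _ ∘ sym) (missed _ ∘ sym) e))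

injective-missing⇒hits : ∀ {m} {f : Fin m → Fin (suc m)} → Injective _≡_ _≡_ f →
  {q : Fin (suc m)} → (∀ i → f i ≢ q) → ∀ {u} → u ≢ q → ∃[ i ] f i ≡ u
injective-missing⇒hits {m} {f} f-inj {q} missed {u} u≢q with any? (λ i → f i Fin.≟ u)
... | yes hit = hit
... | no ¬hit = contradiction (injective-missing⇒≤ g-inj q g-missed) 1+n≰n
  where
  g : Fin (suc m) → Fin (suc m)
  g Fin.zero = u
  g (Fin.suc i) = f i
  g-inj : Injective _≡_ _≡_ g
  g-inj {Fin.zero} {Fin.zero} _ = refl
  g-inj {Fin.zero} {Fin.suc j} u≡fj = contradiction (j , sym u≡fj) ¬hit
  g-inj {Fin.suc i} {Fin.zero} fi≡u = contradiction (i , fi≡u) ¬hit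
  g-inj {Fin.suc i} {Fin.suc j} fi≡fj = cong Fin.suc (f-inj fi≡fj)
  g-missed : ∀ i → g i ≢ q
  g-missed Fin.zero = u≢q
  g-missed (Fin.suc i) = missed i

pair-size : ∀ {n} {x y : Fin n} → x ≢ y → ∣ ⁅ x ⁆ ∪ ⁅ y ⁆ ∣ ≡ 2
pair-size {x = Fin.zero} {Fin.zero} x≢y = contradiction refl x≢y
pair-size {x = Fin.zero} {Fin.suc y} _ rewrite ∪-identityˡ ⁅ y ⁆ = cong suc (∣⁅x⁆∣≡1 y)
pair-size {x = Fin.suc x} {Fin.zero} _ rewrite ∪-identityʳ ⁅ x ⁆ = cong suc (∣⁅x⁆∣≡1 x)
pair-size {x = Fin.suc x} {Fin.suc y} x≢y = pair-size (x≢y ∘ cong Fin.suc)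

∈-pair⁻ : ∀ {n} {u x y : Fin n} → u ∈ ⁅ x ⁆ ∪ ⁅ y ⁆ → u ≡ x ⊎ u ≡ y
∈-pair⁻ {x = x} {y} u∈xy with x∈p∪q⁻ ⁅ x ⁆ ⁅ y ⁆ u∈xy
... | inj₁ u∈x = inj₁ (x∈⁅y⁆⇒x≡y x u∈x)
... | inj₂ u∈y = inj₂ (x∈⁅y⁆⇒x≡y y u∈y)

∈-pairˡ : ∀ {n} (x y : Fin n) → x ∈ ⁅ x ⁆ ∪ ⁅ y ⁆
∈-pairˡ x y = x∈p∪q⁺ (inj₁ (x∈⁅x⁆ x))

∈-pairʳ : ∀ {n} (x y : Fin n) → y ∈ ⁅ x ⁆ ∪ ⁅ y ⁆
∈-pairʳ x y = x∈p∪q⁺ (inj₂ (x∈⁅x⁆ y))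

∉-pair : ∀ {n} {u x y : Fin n} → u ≢ x → u ≢ y → u ∉ ⁅ x ⁆ ∪ ⁅ y ⁆
∉-pair u≢x u≢y u∈xy with ∈-pair⁻ u∈xy
... | inj₁ u≡x = u≢x u≡x
... | inj₂ u≡y = u≢y u≡y

pair-⊆ : ∀ {n} {x y : Fin n} {A : Subset n} → x ∈ A → y ∈ A → ⁅ x ⁆ ∪ ⁅ y ⁆ ⊆ A
pair-⊆ x∈A y∈A u∈xy with ∈-pair⁻ u∈xy
... | inj₁ refl = x∈A
... | inj₂ refl = y∈A

avoiding : ∀ {n} {P : Fin n → Set} {a b : Fin n} → a ≢ b → P a → P b → ∀ w → ∃[ z ] (z ≢ w × P z)
avoiding {a = a} {b} a≢b Pa Pb w with a Fin.≟ w
... | no a≢w = a , a≢w , Pa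
... | yes refl = b , ≢-sym a≢b , Pb

-- Distances, domination and frames

module GraphProperties {n : ℕ} (G : Graph n) where
  open Graph G renaming (sym to edge-sym)

  Adj-sym : ∀ {u v} → Adj G u v → Adj G v u
  Adj-sym {u} {v} uv = trans (edge-sym v u) uv

  Adj-irrefl : ∀ {u} → ¬ Adj G u u
  Adj-irrefl {u} uu with trans (sym uu) (irrefl u)
  ... | ()

  Adj⇒≢ : ∀ {u v} → Adj G u v → u ≢ v
  Adj⇒≢ uv refl = Adj-irrefl uv

  adj? : ∀ u v → Dec (Adj G u v)
  adj? u v = edge u v Bool.≟ true

  weaken : ∀ {j k u v} → j ≤ k → WalkLe G j u v → WalkLe G k u v
  weaken _ here = here
  weaken (s≤s j≤k) (step uw wv) = step uw (weaken j≤k wv)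

  _++_ : ∀ {j k u v w} → WalkLe G j u v → WalkLe G k v w → WalkLe G (j + k) u w
  here ++ q = weaken (m≤n+m _ _) q
  step uw p ++ q = step uw (p ++ q)

  adjacent : ∀ {u v} → Adj G u v → WalkLe G 1 u v
  adjacent uv = step uv here

  reverse : ∀ {k u v} → WalkLe G k u v → WalkLe G k v u
  reverse here = here
  reverse (step {k} uw wv) = weaken (≤-reflexive (+-comm k 1)) (reverse wv ++ adjacent (Adj-sym uw))

  walk? : ∀ k u v → Dec (WalkLe G k u v)
  walk? k u v with u Fin.≟ v
  ... | yes refl = yes here
  walk? zero u v | no u≢v = no λ { here → u≢v refl }
  walk? (suc k) u v | no u≢v with any? (λ w → adj? u w ×-dec walk? k w v)
  ... | yes (w , uw , wv) = yes (step uw wv)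
  ... | no ¬step = no λ { here → u≢v refl ; (step uw wv) → ¬step (_ , uw , wv) }

  walk1⇒Adj : ∀ {u v} → WalkLe G 1 u v → u ≢ v → Adj G u v
  walk1⇒Adj here u≢u = contradiction refl u≢u
  walk1⇒Adj (step uv here) _ = uv

  CommonNeighbour : Fin n → Fin n → Set
  CommonNeighbour u v = ∃[ t ] (Adj G u t × Adj G t v)

  walk2⇒CommonNeighbour : ∀ {u v} → u ≢ v → ¬ Adj G u v → WalkLe G 2 u v → CommonNeighbour u v
  walk2⇒CommonNeighbour u≢v _ here = contradiction refl u≢v
  walk2⇒CommonNeighbour _ u≁v (step uv here) = contradiction uv u≁v
  walk2⇒CommonNeighbour _ _ (step ut (step tv here)) = _ , ut , tv

  Path₃ : Fin n → Fin n → Set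
  Path₃ u v = ∃[ a ] ∃[ b ] (Adj G u a × Adj G a b × Adj G b v)

  walk3⇒Path₃ : ∀ {u v} → WalkLe G 3 u v → ¬ WalkLe G 2 u v → Path₃ u v
  walk3⇒Path₃ here ¬uv = contradiction here ¬uv
  walk3⇒Path₃ (step ua here) ¬uv = contradiction (adjacent ua) (¬uv ∘ weaken (s≤s z≤n))
  walk3⇒Path₃ (step ua (step av here)) ¬uv = contradiction (step ua (step av here)) ¬uv
  walk3⇒Path₃ (step ua (step ab (step bv here))) _ = _ , _ , ua , ab , bv

  Dist-intro : ∀ {k u v} → WalkLe G (suc k) u v → ¬ WalkLe G k u v → Dist G u v (suc k)
  Dist-intro {k} uv ¬uv = uv , least
    where
    least : ∀ j → WalkLe G j _ _ → suc k ≤ j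
    least j uv′ with suc k ≤? j
    ... | yes k<j = k<j
    ... | no k≮j = contradiction (weaken (≤-pred (≰⇒> k≮j)) uv′) ¬uv

  Ecc≤ : Fin n → ℕ → Set
  Ecc≤ v k = ∀ u → WalkLe G k u v

  NoUniversal : Set
  NoUniversal = ∀ v → ¬ Ecc≤ v 1

  ecc≤? : ∀ v k → Dec (Ecc≤ v k)
  ecc≤? v k = all? (λ u → walk? k u v)

  Ecc≤⇒Ecc : ∀ {v k} → Ecc≤ v k → ∃[ e ] (e ≤ k × Ecc G v e)
  Ecc≤⇒Ecc {v} {zero} near = 0 , ≤-refl , near , v , here , λ _ _ → z≤n
  Ecc≤⇒Ecc {v} {suc k} near with ecc≤? v k
  ... | yes near′ with Ecc≤⇒Ecc near′
  ...   | e , e≤k , ecc = e , m≤n⇒m≤1+n e≤k , ecc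
  Ecc≤⇒Ecc {v} {suc k} near | no ¬near with ¬∀⟶∃¬ n _ (λ u → walk? k u v) ¬near
  ...   | u , ¬uv = suc k , ≤-refl , near , u , Dist-intro (near u) ¬uv

  Ecc-least : ∀ {v e k} → Ecc G v e → Ecc≤ v k → e ≤ k
  Ecc-least (_ , u , _ , least) near = least _ (near u)

  Rad-least : ∀ {r v k} → Rad G r → Ecc≤ v k → r ≤ k
  Rad-least (_ , least) near with Ecc≤⇒Ecc near
  ... | e , e≤k , ecc = ≤-trans (least _ e ecc) e≤k

  Rad-unique : ∀ {r r′} → Rad G r → Rad G r′ → r ≡ r′
  Rad-unique rad@(_ , least) rad′@((v′ , ecc′) , _) =
    ≤-antisym (least v′ _ ecc′) (Rad-least rad′ (proj₁ (proj₂ (proj₁ rad))))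

  Rad-intro : ∀ {c r} → Ecc≤ c (suc r) → (∀ v → ¬ Ecc≤ v r) → Rad G (suc r)
  Rad-intro {c} {r} near nowhere-near = (c , ecc) , least
    where
    least : ∀ v e → Ecc G v e → suc r ≤ e
    least v e ecc with suc r ≤? e
    ... | yes r<e = r<e
    ... | no r≮e = contradiction (weaken (≤-pred (≰⇒> r≮e)) ∘ proj₁ ecc) (nowhere-near v)
    ecc : Ecc G c (suc r)
    ecc with Ecc≤⇒Ecc near
    ... | e , e≤r , ecc-e with ≤-antisym e≤r (least c e ecc-e)
    ...   | refl = ecc-e

  Central⇒Ecc≤ : ∀ {r w} → Rad G r → Central G w → Ecc≤ w r
  Central⇒Ecc≤ rad (_ , rad′ , ecc) rewrite Rad-unique rad rad′ = proj₁ ecc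

  Ecc≤⇒Central : ∀ {r v} → Rad G r → Ecc≤ v r → Central G v
  Ecc≤⇒Central rad near with Ecc≤⇒Ecc near
  ... | e , e≤r , ecc with ≤-antisym e≤r (proj₂ rad _ e ecc)
  ...   | refl = e , rad , ecc

  Diam-intro : ∀ {k} → (∀ u v → WalkLe G (suc k) u v) → ¬ (∀ u v → WalkLe G k u v) → Diam G (suc k)
  Diam-intro {k} near ¬near with ¬∀⟶∃¬ n _ (λ u → all? (λ v → walk? k u v)) ¬near
  ... | u₀ , ¬near-u₀ with ¬∀⟶∃¬ n _ (λ v → walk? k u₀ v) ¬near-u₀
  ...   | v₀ , ¬u₀v₀ =
    (v₀ , (λ u → near u v₀) , u₀ , Dist-intro (near u₀ v₀) ¬u₀v₀) ,
    λ v e ecc → Ecc-least ecc (λ u → near u v)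

  Diam-least : ∀ {k D} → (∀ u v → WalkLe G k u v) → Diam G D → D ≤ k
  Diam-least near ((v , ecc) , _) = Ecc-least ecc (λ u → near u v)

  Diam-unique : ∀ {D D′} → Diam G D → Diam G D′ → D ≡ D′
  Diam-unique ((v , ecc) , greatest) ((v′ , ecc′) , greatest′) =
    ≤-antisym (greatest′ v _ ecc) (greatest v′ _ ecc′)

  Ecc≤⇒¬Diametrical : ∀ {k z} → Diam G (suc k) → Ecc≤ z k → ¬ Diametrical G z
  Ecc≤⇒¬Diametrical diam near (_ , diam′ , ecc) rewrite Diam-unique diam′ diam =
    1+n≰n (Ecc-least ecc near)

  ¬Diametrical⇒Ecc≤ : ∀ {k z} → Diam G (suc k) → Ecc≤ z (suc k) → ¬ Diametrical G z → Ecc≤ z k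
  ¬Diametrical⇒Ecc≤ {k} {z} diam near ¬diametrical u with walk? k u z
  ... | yes uz = uz
  ... | no ¬uz = contradiction (_ , diam , near , u , Dist-intro (near u) ¬uz) ¬diametrical

  DominatingPair : Fin n → Fin n → Set
  DominatingPair x y = ∀ u → WalkLe G 1 u x ⊎ WalkLe G 1 u y

  DominatingPair-sym : ∀ {x y} → DominatingPair x y → DominatingPair y x
  DominatingPair-sym dom u with dom u
  ... | inj₁ ux = inj₂ ux
  ... | inj₂ uy = inj₁ uy

  dominated : ∀ {x y u} → DominatingPair x y → u ≢ x → u ≢ y → Adj G u x ⊎ Adj G u y
  dominated {u = u} dom u≢x u≢y with dom u
  ... | inj₁ ux = inj₁ (walk1⇒Adj ux u≢x)
  ... | inj₂ uy = inj₂ (walk1⇒Adj uy u≢y)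

  -- Follow an x–y walk while it stays within distance 1 of x; the next vertex is within
  -- distance 1 of y.
  dominatingPair-walk≤3 : Connected G → ∀ {x y} → DominatingPair x y → WalkLe G 3 x y
  dominatingPair-walk≤3 connected {x} {y} dom = shortcut here (proj₂ (connected x y))
    where
    shortcut : ∀ {k s} → WalkLe G 1 s x → WalkLe G k s y → WalkLe G 3 x y
    shortcut sx here = weaken (s≤s z≤n) (reverse sx)
    shortcut sx (step {w = t} st ty) with dom t
    ... | inj₁ tx = shortcut tx ty
    ... | inj₂ ty′ = reverse sx ++ (adjacent st ++ ty′)

  commonNeighbour-ecc≤2 : ∀ {x y t} → DominatingPair x y → Adj G x t → Adj G t y → Ecc≤ t 2
  commonNeighbour-ecc≤2 dom xt ty u with dom u
  ... | inj₁ ux = ux ++ adjacent xt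
  ... | inj₂ uy = uy ++ adjacent (Adj-sym ty)

  path-ecc≤3 : ∀ {x y a b} → DominatingPair x y → Adj G x a → Adj G a b → Adj G b y → Ecc≤ a 3
  path-ecc≤3 dom xa ab by u with dom u
  ... | inj₁ ux = weaken (s≤s (s≤s z≤n)) (ux ++ adjacent xa)
  ... | inj₂ uy = uy ++ (adjacent (Adj-sym by) ++ adjacent (Adj-sym ab))

  dominatingPair-ecc≤3 : ∀ {x y} → DominatingPair x y → WalkLe G 2 y x → Ecc≤ x 3
  dominatingPair-ecc≤3 dom yx u with dom u
  ... | inj₁ ux = weaken (s≤s z≤n) ux
  ... | inj₂ uy = uy ++ yx

  pair-independent : ∀ {x y} → ¬ Adj G x y → Independent G (⁅ x ⁆ ∪ ⁅ y ⁆)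
  pair-independent x≁y u v u∈xy v∈xy uv with ∈-pair⁻ u∈xy | ∈-pair⁻ v∈xy
  ... | inj₁ refl | inj₁ refl = Adj-irrefl uv
  ... | inj₁ refl | inj₂ refl = x≁y uv
  ... | inj₂ refl | inj₁ refl = x≁y (Adj-sym uv)
  ... | inj₂ refl | inj₂ refl = Adj-irrefl uv

  pair-maximalIndependent : ∀ {x y} → ¬ Adj G x y → DominatingPair x y →
    MaximalIndependent G (⁅ x ⁆ ∪ ⁅ y ⁆)
  pair-maximalIndependent {x} {y} x≁y dom = pair-independent x≁y , maximal
    where
    maximal : ∀ B → ⁅ x ⁆ ∪ ⁅ y ⁆ ⊆ B → Independent G B → B ⊆ ⁅ x ⁆ ∪ ⁅ y ⁆
    maximal B xy⊆B indep {u} u∈B with dom u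
    ... | inj₁ here = ∈-pairˡ x y
    ... | inj₁ (step ux here) = contradiction ux (indep u x u∈B (xy⊆B (∈-pairˡ x y)))
    ... | inj₂ here = ∈-pairʳ x y
    ... | inj₂ (step uy here) = contradiction uy (indep u y u∈B (xy⊆B (∈-pairʳ x y)))

  maximalIndependent-dominates : ∀ {A} → MaximalIndependent G A → ∀ u → ∃[ a ] (a ∈ A × WalkLe G 1 u a)
  maximalIndependent-dominates {A} (indep , maximal) u
    with any? (λ a → (a ∈? A) ×-dec walk? 1 u a)
  ... | yes found = found
  ... | no ¬found = contradiction (u , maximal (A ∪ ⁅ u ⁆) (p⊆p∪q ⁅ u ⁆) indep′ u∈A∪u , here) ¬found
    where
    u∈A∪u : u ∈ A ∪ ⁅ u ⁆
    u∈A∪u = x∈p∪q⁺ (inj₂ (x∈⁅x⁆ u))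
    ∈-A∪u⁻ : ∀ {a} → a ∈ A ∪ ⁅ u ⁆ → a ∈ A ⊎ a ≡ u
    ∈-A∪u⁻ a∈ with x∈p∪q⁻ A ⁅ u ⁆ a∈
    ... | inj₁ a∈A = inj₁ a∈A
    ... | inj₂ a∈u = inj₂ (x∈⁅y⁆⇒x≡y u a∈u)
    indep′ : Independent G (A ∪ ⁅ u ⁆)
    indep′ a b a∈ b∈ with ∈-A∪u⁻ a∈ | ∈-A∪u⁻ b∈
    ... | inj₁ a∈A | inj₁ b∈A = indep a b a∈A b∈A
    ... | inj₁ a∈A | inj₂ refl = λ au → ¬found (a , a∈A , adjacent (Adj-sym au))
    ... | inj₂ refl | inj₁ b∈A = λ ub → ¬found (b , b∈A , adjacent ub)
    ... | inj₂ refl | inj₂ refl = Adj-irrefl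

  another-member : NoUniversal → ∀ {A a} → MaximalIndependent G A → a ∈ A → ∃[ b ] (b ∈ A × b ≢ a)
  another-member noUniversal {a = a} mis a∈A with ¬∀⟶∃¬ n _ (λ u → walk? 1 u a) (noUniversal a)
  ... | u , ¬ua with maximalIndependent-dominates mis u
  ...   | b , b∈A , ub = b , b∈A , λ { refl → ¬ua ub }

  maximalIndependent-size≥2 : NoUniversal → Fin n → ∀ {A} → MaximalIndependent G A → 2 ≤ ∣ A ∣
  maximalIndependent-size≥2 noUniversal v {A} mis with maximalIndependent-dominates mis v
  ... | a , a∈A , _ with another-member noUniversal mis a∈A
  ...   | b , b∈A , b≢a = subst (_≤ ∣ A ∣) (pair-size (≢-sym b≢a)) (p⊆q⇒∣p∣≤∣q∣ (pair-⊆ a∈A b∈A))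

  maximalIndependent-pair : NoUniversal → ∀ {A} → MaximalIndependent G A → ∣ A ∣ ≡ 2 →
    ∃[ x ] ∃[ y ] (x ∈ A × y ∈ A × x ≢ y × ¬ Adj G x y × DominatingPair x y)
  maximalIndependent-pair noUniversal {A} mis@(indep , _) |A|≡2 with nonempty? A
  ... | no empty =
    contradiction (trans (sym |A|≡2) (trans (cong ∣_∣ (Empty-unique empty)) (∣⊥∣≡0 n))) λ ()
  ... | yes (x , x∈A) with another-member noUniversal mis x∈A
  ...   | y , y∈A , y≢x = x , y , x∈A , y∈A , ≢-sym y≢x , indep x y x∈A y∈A , dom
    where
    only : ∀ {u} → u ∈ A → u ≡ x ⊎ u ≡ y
    only {u} u∈A with u Fin.≟ x | u Fin.≟ y
    ... | yes u≡x | _ = inj₁ u≡x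
    ... | no _ | yes u≡y = inj₂ u≡y
    ... | no u≢x | no u≢y = contradiction
      (subst₂ _<_ (pair-size (≢-sym y≢x)) |A|≡2
        (p⊂q⇒∣p∣<∣q∣ (pair-⊆ x∈A y∈A , u , u∈A , ∉-pair u≢x u≢y)))
      (<-irrefl refl)
    dom : DominatingPair x y
    dom u with maximalIndependent-dominates mis u
    ... | a , a∈A , ua with only a∈A
    ...   | inj₁ refl = inj₁ ua
    ...   | inj₂ refl = inj₂ ua

  pair-dominating : ∀ {x y} → MaximalIndependent G (⁅ x ⁆ ∪ ⁅ y ⁆) → DominatingPair x y
  pair-dominating mis u with maximalIndependent-dominates mis u
  ... | a , a∈xy , ua with ∈-pair⁻ a∈xy
  ...   | inj₁ refl = inj₁ ua
  ...   | inj₂ refl = inj₂ ua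

  neighbour : Connected G → ∀ {u v} → u ≢ v → ∃[ a ] Adj G u a
  neighbour connected {u} {v} u≢v with connected u v
  ... | _ , here = contradiction refl u≢v
  ... | _ , step ua _ = _ , ua

  neighbour-outside : ∀ {x y a} → ¬ Adj G x y → Adj G x a → a ≢ x × a ≢ y
  neighbour-outside x≁y xa = ≢-sym (Adj⇒≢ xa) , λ { refl → x≁y xa }

  two-outside : Connected G → NoUniversal → ∀ {x y} → x ≢ y → ¬ Adj G x y →
    ∃[ a ] ∃[ b ] (a ≢ b × (a ≢ x × a ≢ y) × (b ≢ x × b ≢ y))
  two-outside connected noUniversal {x} {y} x≢y x≁y with neighbour connected x≢y
  ... | a , xa with ¬∀⟶∃¬ n _ (λ u → walk? 1 u a) (noUniversal a)
  ...   | u , ¬ua with u Fin.≟ x | u Fin.≟ y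
  ...     | yes refl | _ = contradiction (adjacent xa) ¬ua
  ...     | no u≢x | no u≢y = a , u , (λ { refl → ¬ua here }) , neighbour-outside x≁y xa , u≢x , u≢y
  ...     | no _ | yes refl with neighbour connected (≢-sym x≢y)
  ...       | b , yb = a , b , (λ { refl → ¬ua (adjacent yb) }) , neighbour-outside x≁y xa ,
                       swap (neighbour-outside (x≁y ∘ Adj-sym) yb)

  -- The colour classes {x, y}, {v₂}, {v₃} of colours 1, 2, 3 in a Grundy packing
  -- colouring with n − 1 colours.
  record Frame (x y v₂ v₃ : Fin n) : Set where
    field
      x≢y : x ≢ y
      x≁y : ¬ Adj G x y
      dominating : DominatingPair x y
      v₂≢x : v₂ ≢ x
      v₂≢y : v₂ ≢ y
      v₃≢x : v₃ ≢ x
      v₃≢y : v₃ ≢ y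
      v₃≢v₂ : v₃ ≢ v₂
      v₂-near : ∀ u → u ≢ x → u ≢ y → WalkLe G 2 u v₂
      v₃-near : ∀ u → u ≢ x → u ≢ y → u ≢ v₂ → WalkLe G 3 u v₃

  Frame-swap : ∀ {x y v₂ v₃} → Frame x y v₂ v₃ → Frame y x v₂ v₃
  Frame-swap frame = record
    { x≢y = ≢-sym x≢y
    ; x≁y = x≁y ∘ Adj-sym
    ; dominating = DominatingPair-sym dominating
    ; v₂≢x = v₂≢y
    ; v₂≢y = v₂≢x
    ; v₃≢x = v₃≢y
    ; v₃≢y = v₃≢x
    ; v₃≢v₂ = v₃≢v₂
    ; v₂-near = λ u u≢y u≢x → v₂-near u u≢x u≢y
    ; v₃-near = λ u u≢y u≢x → v₃-near u u≢x u≢y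
    }
    where open Frame frame

  ConditionIII : Set
  ConditionIII = Rad G 3 →
    ∃[ x ] ∃[ y ] (MaximalIndependent G (⁅ x ⁆ ∪ ⁅ y ⁆) × Dist G x y 3
      × ∃[ w ] (Adj G x w × (∀ z → Adj G y z → WalkLe G 2 w z)))

  AvoidsCentralAndNonDiametrical : Subset n → Set
  AvoidsCentralAndNonDiametrical A =
    ∃[ w ] ∃[ z ] (Central G w × ¬ Diametrical G z × z ≢ w × w ∉ A × z ∉ A)

  ConditionIV : Set
  ConditionIV = Rad G 2 → Diam G 4 →
    ∃[ A ] (MaximalIndependent G A × ∣ A ∣ ≡ 2 × AvoidsCentralAndNonDiametrical A)

  HasFrame : Set
  HasFrame = ∃[ x ] ∃[ y ] ∃[ v₂ ] ∃[ v₃ ] Frame x y v₂ v₃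

  commonNeighbour-centre : ∀ {x y} → ¬ Adj G x y → DominatingPair x y → CommonNeighbour x y →
    ∃[ t ] ((t ≢ x × t ≢ y) × Ecc≤ t 2)
  commonNeighbour-centre x≁y dom (t , xt , ty) =
    t , neighbour-outside x≁y xt , commonNeighbour-ecc≤2 dom xt ty

  dominatingPair-ecc≤4 : Connected G → ∀ {x y} → DominatingPair x y → Ecc≤ x 4
  dominatingPair-ecc≤4 connected dom u with dom u
  ... | inj₁ ux = weaken (s≤s z≤n) ux
  ... | inj₂ uy = uy ++ reverse (dominatingPair-walk≤3 connected dom)

  module _ (connected : Connected G) {x y v₂ v₃ : Fin n} (frame : Frame x y v₂ v₃) where
    open Frame frame

    x-ecc≤4 : Ecc≤ x 4
    x-ecc≤4 = dominatingPair-ecc≤4 connected dominating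

    y-ecc≤4 : Ecc≤ y 4
    y-ecc≤4 = dominatingPair-ecc≤4 connected (DominatingPair-sym dominating)

    frame-walk≤4 : ∀ u v → WalkLe G 4 u v
    frame-walk≤4 u v with u Fin.≟ x | u Fin.≟ y | v Fin.≟ x | v Fin.≟ y
    ... | yes refl | _ | _ | _ = reverse (x-ecc≤4 v)
    ... | no _ | yes refl | _ | _ = reverse (y-ecc≤4 v)
    ... | no _ | no _ | yes refl | _ = x-ecc≤4 u
    ... | no _ | no _ | no _ | yes refl = y-ecc≤4 u
    ... | no u≢x | no u≢y | no v≢x | no v≢y = v₂-near u u≢x u≢y ++ reverse (v₂-near v v≢x v≢y)

    frame⇒IndepDomNum : NoUniversal → IndepDomNum G 2
    frame⇒IndepDomNum noUniversal =
      (⁅ x ⁆ ∪ ⁅ y ⁆ , pair-maximalIndependent x≁y dominating , pair-size x≢y) ,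
      λ _ → maximalIndependent-size≥2 noUniversal x

    condition-iii-witness : Rad G 3 → Adj G x v₂ →
      MaximalIndependent G (⁅ x ⁆ ∪ ⁅ y ⁆) × Dist G x y 3
        × ∃[ w ] (Adj G x w × (∀ z → Adj G y z → WalkLe G 2 w z))
    condition-iii-witness rad₃ xv₂ =
      pair-maximalIndependent x≁y dominating ,
      Dist-intro (dominatingPair-walk≤3 connected dominating) (¬common ∘ walk2⇒CommonNeighbour x≢y x≁y) ,
      v₂ , xv₂ , λ z yz → reverse (v₂-near z (λ { refl → x≁y (Adj-sym yz) }) (≢-sym (Adj⇒≢ yz)))
      where
      ¬common : ¬ CommonNeighbour x y
      ¬common (t , xt , ty) = 1+n≰n (Rad-least rad₃ (commonNeighbour-ecc≤2 dominating xt ty))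

    condition-iv-witness : Diam G 4 → ∀ {w p q} → Central G w → w ≢ x × w ≢ y → p ≢ q →
      (p ≢ x × p ≢ y) × Ecc≤ p 3 → (q ≢ x × q ≢ y) × Ecc≤ q 3 →
      AvoidsCentralAndNonDiametrical (⁅ x ⁆ ∪ ⁅ y ⁆)
    condition-iv-witness diam₄ {w} central (w≢x , w≢y) p≢q p-outside q-outside
      with avoiding p≢q p-outside q-outside w
    ... | z , z≢w , (z≢x , z≢y) , z-near =
      w , z , central , Ecc≤⇒¬Diametrical diam₄ z-near , z≢w , ∉-pair w≢x w≢y , ∉-pair z≢x z≢y

    frame⇒ConditionIV : ConditionIV
    frame⇒ConditionIV rad₂@((c , ecc-c) , _) diam₄ =
      ⁅ x ⁆ ∪ ⁅ y ⁆ , pair-maximalIndependent x≁y dominating , pair-size x≢y , witness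
      where
      ¬walk2 : ¬ CommonNeighbour x y → ¬ WalkLe G 2 x y
      ¬walk2 ¬common = ¬common ∘ walk2⇒CommonNeighbour x≢y x≁y
      c-outside : ¬ CommonNeighbour x y → c ≢ x × c ≢ y
      c-outside ¬common = (λ { refl → ¬walk2 ¬common (reverse (proj₁ ecc-c y)) }) ,
                          (λ { refl → ¬walk2 ¬common (proj₁ ecc-c x) })
      witness : AvoidsCentralAndNonDiametrical (⁅ x ⁆ ∪ ⁅ y ⁆)
      witness with any? (λ t → adj? x t ×-dec adj? t y)
      ... | no ¬common with walk3⇒Path₃ (dominatingPair-walk≤3 connected dominating) (¬walk2 ¬common)
      ...   | a , b , xa , ab , by =
        condition-iv-witness diam₄ (2 , rad₂ , ecc-c) (c-outside ¬common) (Adj⇒≢ ab)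
          (neighbour-outside x≁y xa , path-ecc≤3 dominating xa ab by)
          (swap (neighbour-outside (x≁y ∘ Adj-sym) (Adj-sym by)) ,
           path-ecc≤3 (DominatingPair-sym dominating) (Adj-sym by) (Adj-sym ab) (Adj-sym xa))
      witness | yes common@(t , xt , ty) with commonNeighbour-centre x≁y dominating common
      ...   | _ , t-outside , t-near =
        condition-iv-witness diam₄ (Ecc≤⇒Central rad₂ t-near) t-outside (≢-sym v₃≢v₂)
          ((v₂≢x , v₂≢y) , within₃ λ u u≢x u≢y → weaken (n≤1+n 2) (v₂-near u u≢x u≢y))
          ((v₃≢x , v₃≢y) , within₃ v₃-near′)
        where
        -- since d(x, y) ≤ 2, every vertex is within 3 of both x and y
        within₃ : ∀ {p} → (∀ u → u ≢ x → u ≢ y → WalkLe G 3 u p) → Ecc≤ p 3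
        within₃ {p} near u with u Fin.≟ x | u Fin.≟ y
        ... | yes refl | _ =
          reverse (dominatingPair-ecc≤3 dominating (step (Adj-sym ty) (adjacent (Adj-sym xt))) p)
        ... | no _ | yes refl =
          reverse (dominatingPair-ecc≤3 (DominatingPair-sym dominating) (step xt (adjacent ty)) p)
        ... | no u≢x | no u≢y = near u u≢x u≢y
        v₃-near′ : ∀ u → u ≢ x → u ≢ y → WalkLe G 3 u v₃
        v₃-near′ u u≢x u≢y with u Fin.≟ v₂
        ... | yes refl = weaken (n≤1+n 2) (reverse (v₂-near v₃ v₃≢x v₃≢y))
        ... | no u≢v₂ = v₃-near u u≢x u≢y u≢v₂

  frame⇒ConditionIII : Connected G → ∀ {x y v₂ v₃} → Frame x y v₂ v₃ → ConditionIII
  frame⇒ConditionIII connected {x} {y} frame rad₃ with dominated dominating v₂≢x v₂≢y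
    where open Frame frame
  ... | inj₁ v₂x = x , y , condition-iii-witness connected frame rad₃ (Adj-sym v₂x)
  ... | inj₂ v₂y = y , x , condition-iii-witness connected (Frame-swap frame) rad₃ (Adj-sym v₂y)

  Conditions : Set
  Conditions = IndepDomNum G 2 × (∀ D → Diam G D → D ≤ 4) × ConditionIII × ConditionIV

  HasFrame⇒conditions : Connected G → NoUniversal → HasFrame → Conditions
  HasFrame⇒conditions connected noUniversal (_ , _ , _ , _ , frame) =
    frame⇒IndepDomNum connected frame noUniversal ,
    (λ _ → Diam-least (frame-walk≤4 connected frame)) ,
    frame⇒ConditionIII connected frame ,
    frame⇒ConditionIV connected frame

  IndepDomNum2⇒NoUniversal : IndepDomNum G 2 → NoUniversal
  IndepDomNum2⇒NoUniversal (_ , least) v near = 1+n≰n (subst (2 ≤_) |⁅v⁆∪⁅v⁆|≡1 (least _ single))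
    where
    single : MaximalIndependent G (⁅ v ⁆ ∪ ⁅ v ⁆)
    single = pair-maximalIndependent Adj-irrefl (inj₁ ∘ near)
    |⁅v⁆∪⁅v⁆|≡1 : ∣ ⁅ v ⁆ ∪ ⁅ v ⁆ ∣ ≡ 1
    |⁅v⁆∪⁅v⁆|≡1 = trans (cong ∣_∣ (∪-idem ⁅ v ⁆)) (∣⁅x⁆∣≡1 v)

  condition-iii-witness⇒Frame : ∀ {x y w} → MaximalIndependent G (⁅ x ⁆ ∪ ⁅ y ⁆) → Dist G x y 3 →
    Adj G x w → (∀ z → Adj G y z → WalkLe G 2 w z) → ∃[ b ] Frame x y w b
  condition-iii-witness⇒Frame {x} {y} {w} mis (xy , least) xw near-w
    with walk3⇒Path₃ xy (1+n≰n ∘ least 2)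
  ... | a , b , xa , ab , by = b , record
    { x≢y = λ { refl → 1+n≰n (≤-trans (least 0 here) z≤n) }
    ; x≁y = x≁y
    ; dominating = dominating
    ; v₂≢x = ≢-sym (Adj⇒≢ xw)
    ; v₂≢y = λ { refl → x≁y xw }
    ; v₃≢x = λ { refl → x≁y by }
    ; v₃≢y = Adj⇒≢ by
    ; v₃≢v₂ = λ { refl → 1+n≰n (least 2 (step xw (adjacent by))) }
    ; v₂-near = v₂-near
    ; v₃-near = v₃-near
    }
    where
    x≁y : ¬ Adj G x y
    x≁y = proj₁ mis x y (∈-pairˡ x y) (∈-pairʳ x y)
    dominating : DominatingPair x y
    dominating = pair-dominating mis
    v₂-near : ∀ u → u ≢ x → u ≢ y → WalkLe G 2 u w
    v₂-near u u≢x u≢y with dominated dominating u≢x u≢y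
    ... | inj₁ ux = step ux (adjacent xw)
    ... | inj₂ uy = reverse (near-w u (Adj-sym uy))
    v₃-near : ∀ u → u ≢ x → u ≢ y → u ≢ w → WalkLe G 3 u b
    v₃-near u u≢x u≢y _ with dominated dominating u≢x u≢y
    ... | inj₁ ux = step ux (step xa (adjacent ab))
    ... | inj₂ uy = weaken (n≤1+n 2) (step uy (adjacent (Adj-sym by)))

  large-radius⇒HasFrame : Connected G → (∀ v → ¬ Ecc≤ v 2) → ∀ {x y} → x ≢ y → ¬ Adj G x y →
    DominatingPair x y → ConditionIII → HasFrame
  large-radius⇒HasFrame connected eccentric {x} {y} x≢y x≁y dom condition-iii
    with walk3⇒Path₃ (dominatingPair-walk≤3 connected dom) (¬common ∘ walk2⇒CommonNeighbour x≢y x≁y)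
    where
    ¬common : ¬ CommonNeighbour x y
    ¬common (t , xt , ty) = eccentric t (commonNeighbour-ecc≤2 dom xt ty)
  ... | a , b , xa , ab , by with condition-iii (Rad-intro (path-ecc≤3 dom xa ab by) eccentric)
  ...   | x′ , y′ , mis , dist , w , x′w , near-w with condition-iii-witness⇒Frame mis dist x′w near-w
  ...     | b′ , frame = x′ , y′ , w , b′ , frame

  small-diameter⇒HasFrame : Connected G → NoUniversal → ∀ {c} → Ecc≤ c 2 → (∀ u v → WalkLe G 3 u v) →
    ∀ {x y} → x ≢ y → ¬ Adj G x y → DominatingPair x y → HasFrame
  small-diameter⇒HasFrame connected noUniversal {c} c-near near₃ {x} {y} x≢y x≁y dom
    with centre-outside
    where
    centre-outside : ∃[ v ] ((v ≢ x × v ≢ y) × Ecc≤ v 2)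
    centre-outside with c Fin.≟ x | c Fin.≟ y
    ... | yes refl | _ =
      commonNeighbour-centre x≁y dom (walk2⇒CommonNeighbour x≢y x≁y (reverse (c-near y)))
    ... | no _ | yes refl =
      commonNeighbour-centre x≁y dom (walk2⇒CommonNeighbour x≢y x≁y (c-near x))
    ... | no c≢x | no c≢y = c , (c≢x , c≢y) , c-near
  ... | v₂ , (v₂≢x , v₂≢y) , v₂-near with two-outside connected noUniversal x≢y x≁y
  ...   | a , b , a≢b , a-outside , b-outside with avoiding a≢b a-outside b-outside v₂
  ...     | v₃ , v₃≢v₂ , (v₃≢x , v₃≢y) = x , y , v₂ , v₃ , record
    { x≢y = x≢y ; x≁y = x≁y ; dominating = dom
    ; v₂≢x = v₂≢x ; v₂≢y = v₂≢y ; v₃≢x = v₃≢x ; v₃≢y = v₃≢y ; v₃≢v₂ = v₃≢v₂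
    ; v₂-near = λ u _ _ → v₂-near u
    ; v₃-near = λ u _ _ _ → near₃ u v₃
    }

  radius-2-diameter-4⇒HasFrame : NoUniversal → ∀ {c} → Ecc≤ c 2 → ¬ (∀ u v → WalkLe G 3 u v) →
    ConditionIV → HasFrame
  radius-2-diameter-4⇒HasFrame noUniversal c-near far condition-iv = frame (condition-iv rad₂ diam₄)
    where
    rad₂ : Rad G 2
    rad₂ = Rad-intro c-near noUniversal
    near₄ : ∀ u v → WalkLe G 4 u v
    near₄ u v = c-near u ++ reverse (c-near v)
    diam₄ : Diam G 4
    diam₄ = Diam-intro near₄ far
    frame : ∃[ A ] (MaximalIndependent G A × ∣ A ∣ ≡ 2 × AvoidsCentralAndNonDiametrical A) → HasFrame
    frame (A , mis , |A|≡2 , w , z , central , ¬diametrical , z≢w , w∉A , z∉A)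
      with maximalIndependent-pair noUniversal mis |A|≡2
    ... | x , y , x∈A , y∈A , x≢y , x≁y , dom = x , y , w , z , record
      { x≢y = x≢y ; x≁y = x≁y ; dominating = dom
      ; v₂≢x = λ { refl → w∉A x∈A } ; v₂≢y = λ { refl → w∉A y∈A }
      ; v₃≢x = λ { refl → z∉A x∈A } ; v₃≢y = λ { refl → z∉A y∈A } ; v₃≢v₂ = z≢w
      ; v₂-near = λ u _ _ → Central⇒Ecc≤ rad₂ central u
      ; v₃-near = λ u _ _ _ → ¬Diametrical⇒Ecc≤ diam₄ (λ u → near₄ u z) ¬diametrical u
      }

  conditions⇒HasFrame : Connected G → IndepDomNum G 2 → ConditionIII → ConditionIV → HasFrame
  conditions⇒HasFrame connected i@((A , mis , |A|≡2) , _) condition-iii condition-iv =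
    frame (maximalIndependent-pair noUniversal mis |A|≡2)
    where
    noUniversal : NoUniversal
    noUniversal = IndepDomNum2⇒NoUniversal i
    frame : ∃[ x ] ∃[ y ] (x ∈ A × y ∈ A × x ≢ y × ¬ Adj G x y × DominatingPair x y) → HasFrame
    frame (x , y , _ , _ , x≢y , x≁y , dom) with any? (λ c → ecc≤? c 2)
    ... | no eccentric =
      large-radius⇒HasFrame connected (λ v near → eccentric (v , near)) x≢y x≁y dom condition-iii
    ... | yes (c , c-near) with all? (λ u → all? (λ v → walk? 3 u v))
    ...   | yes near₃ = small-diameter⇒HasFrame connected noUniversal c-near near₃ x≢y x≁y dom
    ...   | no far = radius-2-diameter-4⇒HasFrame noUniversal c-near far condition-iv

-- Grundy packing colourings

colourOfPosition : ℕ → ℕ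
colourOfPosition zero = 1
colourOfPosition (suc i) = suc i

colourOfPosition-≡ : ∀ {i j} → colourOfPosition i ≡ colourOfPosition j →
  i ≡ j ⊎ (i ≡ 0 × j ≡ 1) ⊎ (i ≡ 1 × j ≡ 0)
colourOfPosition-≡ {zero} {zero} _ = inj₁ refl
colourOfPosition-≡ {zero} {suc zero} _ = inj₂ (inj₁ (refl , refl))
colourOfPosition-≡ {suc zero} {zero} _ = inj₂ (inj₂ (refl , refl))
colourOfPosition-≡ {suc i} {suc j} e = inj₁ e
colourOfPosition-≡ {zero} {suc (suc j)} ()
colourOfPosition-≡ {suc (suc i)} {zero} ()

colourOfPosition-range : ∀ {i k} → 1 ≤ k → i < suc k → 1 ≤ colourOfPosition i × colourOfPosition i ≤ k
colourOfPosition-range {zero} 1≤k _ = ≤-refl , 1≤k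
colourOfPosition-range {suc i} _ i<k = s≤s z≤n , ≤-pred i<k

colourOfPosition-< : ∀ {i j} → 1 ≤ j → j < colourOfPosition i → j < i
colourOfPosition-< {zero} 1≤j (s≤s j≤0) = contradiction (≤-trans 1≤j j≤0) λ ()
colourOfPosition-< {suc i} _ j<i = j<i

module GrundyColourings {m : ℕ} (G : Graph (suc m)) where
  open GraphProperties G

  universal⇒colouring : ∀ {v} → Ecc≤ v 1 → ∃[ c ] GrundyPackingColoring G (suc m) c
  universal⇒colouring {v} near with placeFirst 1 (λ _ → v) (λ { zero _ → [] ; (suc _) (s≤s ()) })
  ... | σ , placed = colour , in-range , onto , packing , grundy
    where
    colour : Fin (suc m) → ℕ
    colour u = suc (toℕ (σ ⟨$⟩ʳ u))
    in-range : ∀ u → 1 ≤ colour u × colour u ≤ suc m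
    in-range u = s≤s z≤n , toℕ<n _
    onto : ∀ i → 1 ≤ i → i ≤ suc m → ∃[ u ] colour u ≡ i
    onto (suc i) _ i<n with position-surjective σ i<n
    ... | u , e = u , cong suc e
    packing : ∀ u w → u ≢ w → colour u ≡ colour w → ¬ WalkLe G (colour u) u w
    packing u w u≢w cu≡cw _ = u≢w (position-injective σ (suc-injective cu≡cw))
    grundy : ∀ u j → 1 ≤ j → j < colour u → ∃[ w ] (colour w ≡ j × WalkLe G j w u)
    grundy u 1 _ _ = v , cong suc (placed 0 (s≤s z≤n)) , reverse (near u)
    grundy u (suc (suc j)) _ j<cu
      with onto (suc (suc j)) (s≤s z≤n) (≤-trans (<⇒≤ j<cu) (proj₂ (in-range u)))
    ... | w , cw≡j = w , cw≡j , weaken (s≤s (s≤s z≤n)) (near w ++ reverse (near u))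

  module Colouring {k : ℕ} {c : Fin (suc m) → ℕ} (colouring : GrundyPackingColoring G k c) where

    in-range : ∀ v → 1 ≤ c v × c v ≤ k
    in-range = proj₁ colouring

    onto : ∀ i → 1 ≤ i → i ≤ k → ∃[ v ] c v ≡ i
    onto = proj₁ (proj₂ colouring)

    packing : ∀ u v → u ≢ v → c u ≡ c v → ¬ WalkLe G (c u) u v
    packing = proj₁ (proj₂ (proj₂ colouring))

    grundy : ∀ v j → 1 ≤ j → j < c v → ∃[ u ] (c u ≡ j × WalkLe G j u v)
    grundy = proj₂ (proj₂ (proj₂ colouring))

    colour≢1⇒colour≥2 : ∀ {u} → c u ≢ 1 → 2 ≤ c u
    colour≢1⇒colour≥2 {u} cu≢1 = ≤∧≢⇒< (proj₁ (in-range u)) (≢-sym cu≢1)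

    another-colour-1 : NoUniversal → ∀ p → ∃[ q ] (c q ≡ 1 × q ≢ p)
    another-colour-1 noUniversal p with ¬∀⟶∃¬ _ _ (λ u → walk? 1 u p) (noUniversal p)
    ... | u , ¬up with c u ≟ 1
    ...   | yes cu≡1 = u , cu≡1 , λ { refl → ¬up here }
    ...   | no cu≢1 with grundy u 1 ≤-refl (colour≢1⇒colour≥2 cu≢1)
    ...     | q , cq≡1 , qu = q , cq≡1 , λ { refl → ¬up (reverse qu) }

    representative : Fin k → Fin (suc m)
    representative i = proj₁ (onto (suc (toℕ i)) (s≤s z≤n) (toℕ<n i))

    representative-colour : ∀ i → c (representative i) ≡ suc (toℕ i)
    representative-colour i = proj₂ (onto (suc (toℕ i)) (s≤s z≤n) (toℕ<n i))

    representative-colour-injective : ∀ {i j} → c (representative i) ≡ c (representative j) → i ≡ j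
    representative-colour-injective {i} {j} e = toℕ-injective (suc-injective
      (trans (sym (representative-colour i)) (trans e (representative-colour j))))

    representative-injective : Injective _≡_ _≡_ representative
    representative-injective = representative-colour-injective ∘ cong c

    missed-colour-1 : NoUniversal → ∀ i₁ → toℕ i₁ ≡ 0 →
      ∃[ q ] (c q ≡ 1 × q ≢ representative i₁ × ∀ i → representative i ≢ q)
    missed-colour-1 noUniversal i₁ i₁≡0 with another-colour-1 noUniversal (representative i₁)
    ... | q , cq≡1 , q≢p = q , cq≡1 , q≢p , missed
      where
      missed : ∀ i → representative i ≢ q
      missed i refl = q≢p (cong representative (representative-colour-injective
        (trans cq≡1 (sym (trans (representative-colour i₁) (cong suc i₁≡0))))))

  colours≤m : NoUniversal → ∀ {k c} → GrundyPackingColoring G k c → k ≤ m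
  colours≤m noUniversal {zero} _ = z≤n
  colours≤m noUniversal {suc _} colouring =
    let q , _ , _ , missed = missed-colour-1 noUniversal Fin.zero refl
    in injective-missing⇒≤ representative-injective q missed
    where open Colouring colouring

  record ColourClasses (c : Fin (suc m) → ℕ) : Set where
    field
      p q : Fin (suc m)
      p≢q : p ≢ q
      p-colour : c p ≡ 1
      q-colour : c q ≡ 1
      colour-1 : ∀ u → c u ≡ 1 → u ≡ p ⊎ u ≡ q
      singleton : ∀ u v → c u ≡ c v → 2 ≤ c u → u ≡ v

  colour-classes : NoUniversal → ∀ {c} → GrundyPackingColoring G m c → ColourClasses c
  colour-classes noUniversal {c} colouring = classes (missed-colour-1 noUniversal i₁ (toℕ-fromℕ< 1≤m))
    where
    open Colouring colouring
    1≤m : 1 ≤ m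
    1≤m = ≤-trans (proj₁ (in-range Fin.zero)) (proj₂ (in-range Fin.zero))
    i₁ : Fin m
    i₁ = fromℕ< 1≤m
    p : Fin (suc m)
    p = representative i₁
    p-colour : c p ≡ 1
    p-colour = trans (representative-colour i₁) (cong suc (toℕ-fromℕ< 1≤m))
    classes : ∃[ q ] (c q ≡ 1 × q ≢ p × ∀ i → representative i ≢ q) → ColourClasses c
    classes (q , q-colour , q≢p , missed) = record
      { p = p ; q = q ; p≢q = ≢-sym q≢p ; p-colour = p-colour ; q-colour = q-colour
      ; colour-1 = colour-1 ; singleton = singleton }
      where
      -- m representatives among m + 1 vertices: every vertex but q is one
      hit : ∀ {u} → u ≢ q → ∃[ i ] representative i ≡ u
      hit = injective-missing⇒hits representative-injective missed
      colour-1 : ∀ u → c u ≡ 1 → u ≡ p ⊎ u ≡ q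
      colour-1 u cu≡1 with u Fin.≟ q
      ... | yes u≡q = inj₂ u≡q
      ... | no u≢q with hit u≢q
      ...   | i , refl =
        inj₁ (cong representative (representative-colour-injective (trans cu≡1 (sym p-colour))))
      ≢q : ∀ {u} → 2 ≤ c u → u ≢ q
      ≢q 2≤cu refl = 1+n≰n (subst (2 ≤_) q-colour 2≤cu)
      singleton : ∀ u v → c u ≡ c v → 2 ≤ c u → u ≡ v
      singleton u v cu≡cv 2≤cu with hit (≢q 2≤cu) | hit (≢q (subst (2 ≤_) cu≡cv 2≤cu))
      ... | i , refl | j , refl = cong representative (representative-colour-injective cu≡cv)

  module _ (connected : Connected G) (noUniversal : NoUniversal) {c : Fin (suc m) → ℕ}
           (colouring : GrundyPackingColoring G m c) (classes : ColourClasses c) where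
    open Colouring colouring
    open ColourClasses classes

    colours-differ : ∀ {u v i j} → c u ≡ i → c v ≡ j → i ≢ j → u ≢ v
    colours-differ refl refl i≢j u≡v = i≢j (cong c u≡v)

    outside-colour≥2 : ∀ {u} → u ≢ p → u ≢ q → 2 ≤ c u
    outside-colour≥2 {u} u≢p u≢q with c u ≟ 1
    ... | no cu≢1 = colour≢1⇒colour≥2 cu≢1
    ... | yes cu≡1 with colour-1 u cu≡1
    ...   | inj₁ u≡p = contradiction u≡p u≢p
    ...   | inj₂ u≡q = contradiction u≡q u≢q

    -- a colour j ≥ 2 has a single vertex w, so w serves every vertex of larger colour
    near-singleton : ∀ {j w u} → c w ≡ j → 2 ≤ j → j ≤ c u → WalkLe G j w u
    near-singleton {j} {w} {u} refl 2≤j j≤cu with c w ≟ c u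
    ... | yes cw≡cu = subst (WalkLe G j w) (singleton w u cw≡cu 2≤j) here
    ... | no cw≢cu with grundy u j (≤-trans (s≤s z≤n) 2≤j) (≤∧≢⇒< j≤cu cw≢cu)
    ...   | w′ , cw′≡j , w′u =
      subst (λ t → WalkLe G j t u) (singleton w′ w cw′≡j (subst (2 ≤_) (sym cw′≡j) 2≤j)) w′u

    p≁q : ¬ Adj G p q
    p≁q pq = packing p q p≢q (trans p-colour (sym q-colour))
      (subst (λ j → WalkLe G j p q) (sym p-colour) (adjacent pq))

    colour-1-dominating : DominatingPair p q
    colour-1-dominating u with c u ≟ 1
    ... | yes cu≡1 with colour-1 u cu≡1
    ...   | inj₁ refl = inj₁ here
    ...   | inj₂ refl = inj₂ here
    colour-1-dominating u | no cu≢1 with grundy u 1 ≤-refl (colour≢1⇒colour≥2 cu≢1)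
    ...   | w , cw≡1 , wu with colour-1 w cw≡1
    ...     | inj₁ refl = inj₁ (reverse wu)
    ...     | inj₂ refl = inj₂ (reverse wu)

    three-colours : 3 ≤ m
    three-colours with two-outside connected noUniversal p≢q p≁q
    ... | a , b , a≢b , (a≢p , a≢q) , (b≢p , b≢q) with 2 ≟ c a
    ...   | no 2≢ca = ≤-trans (≤∧≢⇒< (outside-colour≥2 a≢p a≢q) 2≢ca) (proj₂ (in-range a))
    ...   | yes 2≡ca = ≤-trans (≤∧≢⇒< (outside-colour≥2 b≢p b≢q) 2≢cb) (proj₂ (in-range b))
      where
      2≢cb : 2 ≢ c b
      2≢cb 2≡cb = a≢b (singleton a b (trans (sym 2≡ca) 2≡cb) (outside-colour≥2 a≢p a≢q))

    colouring⇒HasFrame : HasFrame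
    colouring⇒HasFrame
      with onto 2 (s≤s z≤n) (≤-trans (n≤1+n 2) three-colours) | onto 3 (s≤s z≤n) three-colours
    ... | v₂ , v₂-colour | v₃ , v₃-colour = p , q , v₂ , v₃ , record
      { x≢y = p≢q
      ; x≁y = p≁q
      ; dominating = colour-1-dominating
      ; v₂≢x = colours-differ v₂-colour p-colour λ ()
      ; v₂≢y = colours-differ v₂-colour q-colour λ ()
      ; v₃≢x = colours-differ v₃-colour p-colour λ ()
      ; v₃≢y = colours-differ v₃-colour q-colour λ ()
      ; v₃≢v₂ = colours-differ v₃-colour v₂-colour λ ()
      ; v₂-near = λ u u≢p u≢q → reverse (near-singleton v₂-colour ≤-refl (outside-colour≥2 u≢p u≢q))
      ; v₃-near = λ u u≢p u≢q u≢v₂ → reverse (near-singleton v₃-colour (n≤1+n 2)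
          (≤∧≢⇒< (outside-colour≥2 u≢p u≢q) λ 2≡cu →
            u≢v₂ (singleton u v₂ (trans (sym 2≡cu) (sym v₂-colour)) (outside-colour≥2 u≢p u≢q))))
      }

  module _ {x y v₂ v₃ : Fin (suc m)} (frame : Frame x y v₂ v₃) where
    open Frame frame

    listed : ℕ → Fin (suc m)
    listed 0 = x
    listed 1 = y
    listed 2 = v₂
    listed _ = v₃

    listed-fresh : ∀ j → j < 4 → All (listed j ≢_) (applyUpTo listed j)
    listed-fresh 0 _ = []
    listed-fresh 1 _ = ≢-sym x≢y ∷ []
    listed-fresh 2 _ = v₂≢x ∷ v₂≢y ∷ []
    listed-fresh 3 _ = v₃≢x ∷ v₃≢y ∷ v₃≢v₂ ∷ []
    listed-fresh (suc (suc (suc (suc _)))) (s≤s (s≤s (s≤s (s≤s ()))))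

    module _ (σ : Permutation (suc m) (suc m)) (placed : ∀ i → i < 4 → toℕ (σ ⟨$⟩ʳ listed i) ≡ i) where

      position : Fin (suc m) → ℕ
      position u = toℕ (σ ⟨$⟩ʳ u)

      frameColour : Fin (suc m) → ℕ
      frameColour u = colourOfPosition (position u)

      frameColour-x : frameColour x ≡ 1
      frameColour-x = cong colourOfPosition (placed 0 (s≤s z≤n))

      frameColour-y : frameColour y ≡ 1
      frameColour-y = cong colourOfPosition (placed 1 (s≤s (s≤s z≤n)))

      frameColour-v₂ : frameColour v₂ ≡ 2
      frameColour-v₂ = cong colourOfPosition (placed 2 (s≤s (s≤s (s≤s z≤n))))

      frameColour-v₃ : frameColour v₃ ≡ 3
      frameColour-v₃ = cong colourOfPosition (placed 3 ≤-refl)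

      at : ∀ {u} i → i < 4 → position u ≡ i → u ≡ listed i
      at i i<4 pu≡i = position-injective σ (trans pu≡i (sym (placed i i<4)))

      below : ∀ {u} i → i < 4 → i < position u → u ≢ listed i
      below i i<4 i<pu refl = <⇒≢ i<pu (sym (placed i i<4))

      outside-xy : ∀ {u} → 1 < position u → u ≢ x × u ≢ y
      outside-xy 1<pu = below 0 (s≤s z≤n) (<-trans (s≤s z≤n) 1<pu) , below 1 (s≤s (s≤s z≤n)) 1<pu

      ¬walk1-xy : ¬ WalkLe G 1 x y
      ¬walk1-xy xy = x≁y (walk1⇒Adj xy x≢y)

      frameColour-packing : ∀ u v → u ≢ v → frameColour u ≡ frameColour v →
        ¬ WalkLe G (frameColour u) u v
      frameColour-packing u v u≢v cu≡cv uv with colourOfPosition-≡ cu≡cv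
      ... | inj₁ pu≡pv = u≢v (position-injective σ pu≡pv)
      ... | inj₂ (inj₁ (pu≡0 , pv≡1)) with at 0 (s≤s z≤n) pu≡0 | at 1 (s≤s (s≤s z≤n)) pv≡1
      ...   | refl | refl = ¬walk1-xy (subst (λ j → WalkLe G j x y) frameColour-x uv)
      frameColour-packing u v u≢v cu≡cv uv | inj₂ (inj₂ (pu≡1 , pv≡0))
        with at 1 (s≤s (s≤s z≤n)) pu≡1 | at 0 (s≤s z≤n) pv≡0
      ...   | refl | refl = ¬walk1-xy (reverse (subst (λ j → WalkLe G j y x) frameColour-y uv))

      frameColour-serves : ∀ v j → 1 ≤ j → j < position v → ∃[ w ] (frameColour w ≡ j × WalkLe G j w v)
      frameColour-serves v 1 _ 1<pv with outside-xy 1<pv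
      ... | v≢x , v≢y with dominated dominating v≢x v≢y
      ...   | inj₁ vx = x , frameColour-x , adjacent (Adj-sym vx)
      ...   | inj₂ vy = y , frameColour-y , adjacent (Adj-sym vy)
      frameColour-serves v 2 _ 2<pv with outside-xy (≤-trans (n≤1+n 2) 2<pv)
      ... | v≢x , v≢y = v₂ , frameColour-v₂ , reverse (v₂-near v v≢x v≢y)
      frameColour-serves v 3 _ 3<pv with outside-xy (≤-trans (s≤s (s≤s z≤n)) 3<pv)
      ... | v≢x , v≢y = v₃ , frameColour-v₃ ,
        reverse (v₃-near v v≢x v≢y (below 2 (s≤s (s≤s (s≤s z≤n))) (≤-trans (n≤1+n 3) 3<pv)))
      frameColour-serves v j@(suc (suc (suc (suc _)))) _ j<pv
        with position-surjective σ (<-trans j<pv (toℕ<n _))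
      ... | w , pw≡j with outside-xy (subst (1 <_) (sym pw≡j) (s≤s (s≤s z≤n)))
                        | outside-xy (≤-trans (s≤s (s≤s z≤n)) j<pv)
      ...   | w≢x , w≢y | v≢x , v≢y = w , cong colourOfPosition pw≡j ,
        weaken (s≤s (s≤s (s≤s (s≤s z≤n)))) (v₂-near w w≢x w≢y ++ reverse (v₂-near v v≢x v≢y))

      frame⇒colouring : GrundyPackingColoring G m frameColour
      frame⇒colouring = in-range , onto , frameColour-packing , grundy
        where
        3≤m : 3 ≤ m
        3≤m = ≤-pred (subst (_< suc m) (placed 3 ≤-refl) (toℕ<n _))
        in-range : ∀ u → 1 ≤ frameColour u × frameColour u ≤ m
        in-range u = colourOfPosition-range (≤-trans (s≤s z≤n) 3≤m) (toℕ<n _)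
        onto : ∀ i → 1 ≤ i → i ≤ m → ∃[ u ] frameColour u ≡ i
        onto (suc i) _ i<m with position-surjective σ (s≤s i<m)
        ... | u , pu≡i = u , cong colourOfPosition pu≡i
        grundy : ∀ v j → 1 ≤ j → j < frameColour v → ∃[ w ] (frameColour w ≡ j × WalkLe G j w v)
        grundy v j 1≤j j<cv = frameColour-serves v j 1≤j (colourOfPosition-< 1≤j j<cv)

  HasFrame⇒colouring : HasFrame → ∃[ c ] GrundyPackingColoring G m c
  HasFrame⇒colouring (_ , _ , _ , _ , frame) =
    let σ , placed = placeFirst 4 (listed frame) (listed-fresh frame)
    in frameColour frame σ placed , frame⇒colouring frame σ placed

  GrundyPackingNumber⇒NoUniversal : GrundyPackingNumber G m → NoUniversal
  GrundyPackingNumber⇒NoUniversal (_ , maximum) v near =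
    1+n≰n (maximum _ _ (proj₂ (universal⇒colouring near)))

theorem10 : (n : ℕ) → 1 ≤ n → (G : Graph n) → Connected G →
  GrundyPackingNumber G (n ∸ 1)
  ⇔
  ( IndepDomNum G 2
  × (∀ D → Diam G D → D ≤ 4)
  × (Rad G 3 →
      ∃[ x ] ∃[ y ] (MaximalIndependent G (⁅ x ⁆ ∪ ⁅ y ⁆)
        × Dist G x y 3
        × ∃[ w ] (Adj G x w × (∀ z → Adj G y z → WalkLe G 2 w z))))
  × (Rad G 2 → Diam G 4 →
      ∃[ A ] (MaximalIndependent G A × ∣ A ∣ ≡ 2
        × ∃[ w ] ∃[ z ] (Central G w × ¬ Diametrical G z × z ≢ w
          × w ∉ A × z ∉ A))))
theorem10 (suc m) _ G connected = mk⇔ necessary sufficient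
  where
  open GraphProperties G
  open GrundyColourings G

  necessary : GrundyPackingNumber G m → Conditions
  necessary Γ@((_ , colouring) , _) =
    HasFrame⇒conditions connected noUniversal
      (colouring⇒HasFrame connected noUniversal colouring (colour-classes noUniversal colouring))
    where
    noUniversal : NoUniversal
    noUniversal = GrundyPackingNumber⇒NoUniversal Γ

  sufficient : Conditions → GrundyPackingNumber G m
  sufficient (i , _ , iii , iv) =
    HasFrame⇒colouring (conditions⇒HasFrame connected i iii iv) ,
    λ _ _ → colours≤m (IndepDomNum2⇒NoUniversal i)
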